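{- For every formula $A$ of $\mathbf{EQC}$: (1) if $A$ contains no occurrence of $\forall$, then $\vdash_{\mathbf{IQC}}A^F\leftrightarrow\neg\neg A^{d\Box}$; (2) $\vdash_{\mathbf{IQC}}A^F\leftrightarrow\neg\neg A^F$.
   Context: $\mathbf{IQC}$ is intuitionistic first-order predicate calculus with equality, primitives $\vee,\wedge,\supset,\exists,\forall,\bot$; $\neg A:=A\supset\bot$, $\neg^2A:=\neg\neg A$. $\mathbf{EQC}$ is classical first-order predicate calculus with equality plus the S4 modal operator $\Box$. Translation $A^F$: $A^F=\neg^2A$ for atomic $A$; $(A\vee B)^F=\neg^2(A^F\vee B^F)$; $(A\wedge B)^F=A^F\wedge B^F$; $(A\supset B)^F=A^F\supset B^F$; $(\Box A)^F=A^F$; $(\exists xA)^F=\neg^2\exists xA^F$; $(\forall xA)^F=\forall xA^F$. $\Box$-deleting translation $A^{d\Box}$: identity on atomic formulas, commutes with $\vee,\wedge,\supset,\exists,\forall$, and $(\Box A)^{d\Box}=A^{d\Box}$. -}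

module Defs where

open import Data.Nat using (ℕ; zero; suc)
open import Data.Vec using (Vec; []; _∷_)
open import Data.List using (List; []; _∷_; map)
open import Data.List.Membership.Propositional using (_∈_)
open import Data.Unit using (⊤)
open import Data.Product using (_×_)
open import Data.Empty using (⊥)

-- A first-order signature: Fn n = function symbols of arity n
-- (constants have arity 0), Pr n = predicate symbols of arity n.
-- Variables are de Bruijn indices.
module FOL (Fn Pr : ℕ → Set) where

  data Term : Set where
    var : ℕ → Term
    fun : ∀ {n} → Fn n → Vec Term n → Term

  infixr 6 _∧'_
  infixr 5 _∨'_
  infixr 4 _⊃_
  data Fm : Set where
    atom : ∀ {n} → Pr n → Vec Term n → Fm
    _≐_  : Term → Term → Fm
    ⊥'   : Fm
    _∨'_ _∧'_ _⊃_ : Fm → Fm → Fm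
    ∃' ∀' : Fm → Fm          -- binds de Bruijn variable 0

  data MFm : Set where
    atom : ∀ {n} → Pr n → Vec Term n → MFm
    _≐_  : Term → Term → MFm
    ⊥'   : MFm
    _∨'_ _∧'_ _⊃_ : MFm → MFm → MFm
    ∃' ∀' : MFm → MFm
    □    : MFm → MFm

  ¬' : Fm → Fm
  ¬' A = A ⊃ ⊥'

  ¬² : Fm → Fm
  ¬² A = ¬' (¬' A)

  _⇔_ : Fm → Fm → Fm
  A ⇔ B = (A ⊃ B) ∧' (B ⊃ A)

  mutual
    renT : (ℕ → ℕ) → Term → Term
    renT ρ (var x) = var (ρ x)
    renT ρ (fun f ts) = fun f (renTs ρ ts)

    renTs : ∀ {n} → (ℕ → ℕ) → Vec Term n → Vec Term n
    renTs ρ [] = []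
    renTs ρ (t ∷ ts) = renT ρ t ∷ renTs ρ ts

  mutual
    subT : (ℕ → Term) → Term → Term
    subT σ (var x) = σ x
    subT σ (fun f ts) = fun f (subTs σ ts)

    subTs : ∀ {n} → (ℕ → Term) → Vec Term n → Vec Term n
    subTs σ [] = []
    subTs σ (t ∷ ts) = subT σ t ∷ subTs σ ts

  exts : (ℕ → Term) → ℕ → Term
  exts σ zero = var zero
  exts σ (suc x) = renT suc (σ x)

  sub : (ℕ → Term) → Fm → Fm
  sub σ (atom P ts) = atom P (subTs σ ts)
  sub σ (t ≐ u) = subT σ t ≐ subT σ u
  sub σ ⊥' = ⊥'
  sub σ (A ∨' B) = sub σ A ∨' sub σ B
  sub σ (A ∧' B) = sub σ A ∧' sub σ B
  sub σ (A ⊃ B) = sub σ A ⊃ sub σ B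
  sub σ (∃' A) = ∃' (sub (exts σ) A)
  sub σ (∀' A) = ∀' (sub (exts σ) A)

  ↑ : Fm → Fm
  ↑ = sub (λ x → var (suc x))

  inst : Term → ℕ → Term
  inst t zero = t
  inst t (suc x) = var x

  _[_] : Fm → Term → Fm
  A [ t ] = sub (inst t) A

  infix 2 _⊢_
  data _⊢_ (Γ : List Fm) : Fm → Set where
    ass  : ∀ {A} → A ∈ Γ → Γ ⊢ A
    ⊥E   : ∀ {A} → Γ ⊢ ⊥' → Γ ⊢ A
    ∧I   : ∀ {A B} → Γ ⊢ A → Γ ⊢ B → Γ ⊢ A ∧' B
    ∧E₁  : ∀ {A B} → Γ ⊢ A ∧' B → Γ ⊢ A
    ∧E₂  : ∀ {A B} → Γ ⊢ A ∧' B → Γ ⊢ B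
    ∨I₁  : ∀ {A B} → Γ ⊢ A → Γ ⊢ A ∨' B
    ∨I₂  : ∀ {A B} → Γ ⊢ B → Γ ⊢ A ∨' B
    ∨E   : ∀ {A B C} → Γ ⊢ A ∨' B → (A ∷ Γ) ⊢ C → (B ∷ Γ) ⊢ C → Γ ⊢ C
    ⊃I   : ∀ {A B} → (A ∷ Γ) ⊢ B → Γ ⊢ A ⊃ B
    ⊃E   : ∀ {A B} → Γ ⊢ A ⊃ B → Γ ⊢ A → Γ ⊢ B
    ∀I   : ∀ {A} → map ↑ Γ ⊢ A → Γ ⊢ ∀' A
    ∀E   : ∀ {A} (t : Term) → Γ ⊢ ∀' A → Γ ⊢ A [ t ]
    ∃I   : ∀ {A} (t : Term) → Γ ⊢ A [ t ] → Γ ⊢ ∃' A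
    ∃E   : ∀ {A C} → Γ ⊢ ∃' A → (A ∷ map ↑ Γ) ⊢ ↑ C → Γ ⊢ C
    ≐refl : ∀ (t : Term) → Γ ⊢ t ≐ t
    ≐E   : ∀ {A} (t u : Term) → Γ ⊢ t ≐ u → Γ ⊢ A [ t ] → Γ ⊢ A [ u ]

  ⊢IQC : Fm → Set
  ⊢IQC A = [] ⊢ A

  -- The translation A^F (⊥ counts as atomic).
  _ᶠ : MFm → Fm
  atom P ts ᶠ = ¬² (atom P ts)
  (t ≐ u) ᶠ = ¬² (t ≐ u)
  ⊥' ᶠ = ¬² ⊥'
  (A ∨' B) ᶠ = ¬² (A ᶠ ∨' B ᶠ)
  (A ∧' B) ᶠ = A ᶠ ∧' B ᶠ
  (A ⊃ B) ᶠ = A ᶠ ⊃ B ᶠ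
  □ A ᶠ = A ᶠ
  ∃' A ᶠ = ¬² (∃' (A ᶠ))
  ∀' A ᶠ = ∀' (A ᶠ)

  _ᵈ : MFm → Fm
  atom P ts ᵈ = atom P ts
  (t ≐ u) ᵈ = t ≐ u
  ⊥' ᵈ = ⊥'
  (A ∨' B) ᵈ = A ᵈ ∨' B ᵈ
  (A ∧' B) ᵈ = A ᵈ ∧' B ᵈ
  (A ⊃ B) ᵈ = A ᵈ ⊃ B ᵈ
  □ A ᵈ = A ᵈ
  ∃' A ᵈ = ∃' (A ᵈ)
  ∀' A ᵈ = ∀' (A ᵈ)

  NoForall : MFm → Set
  NoForall (atom P ts) = ⊤
  NoForall (t ≐ u) = ⊤
  NoForall ⊥' = ⊤
  NoForall (A ∨' B) = NoForall A × NoForall B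
  NoForall (A ∧' B) = NoForall A × NoForall B
  NoForall (A ⊃ B) = NoForall A × NoForall B
  NoForall (□ A) = NoForall A
  NoForall (∃' A) = NoForall A
  NoForall (∀' A) = ⊥

-- ¬² is a monad on formulas of IQC (unit X ⊃ ¬² X, Kleisli extension), and
-- it commutes with ∧ and ⊃ up to provable equivalence, with ∨ and ∃ when they
-- are themselves under ¬². Every clause of A ᶠ is either a ¬²-formula or built
-- from such by ∧, ⊃ and ∀, all of which preserve stability ¬² X ⊃ X; this gives
-- (2). Without ∀, the commutations carry A ᶠ to ¬² (A ᵈ) clause by clause,
-- which gives (1); ¬² does not commute with ∀ intuitionistically.
module Submission where

open import Defs
open import Data.Nat using (ℕ; zero; suc)
open import Data.Product using (_×_; _,_)
open import Data.Vec using (Vec; []; _∷_)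
open import Data.List using (_∷_)
open import Data.List.Relation.Unary.Any using (here; there)
open import Relation.Binary.PropositionalEquality
  using (_≡_; refl; sym; trans; cong; cong₂; subst)

module _ {Fn Pr : ℕ → Set} where
  open FOL Fn Pr

  wk : ℕ → Term
  wk x = var (suc x)

  mutual
    subT-renT : ∀ σ ρ t → subT σ (renT ρ t) ≡ subT (λ x → σ (ρ x)) t
    subT-renT σ ρ (var x) = refl
    subT-renT σ ρ (fun f ts) = cong (fun f) (subTs-renTs σ ρ ts)

    subTs-renTs : ∀ {n} σ ρ (ts : Vec Term n) →
                  subTs σ (renTs ρ ts) ≡ subTs (λ x → σ (ρ x)) ts
    subTs-renTs σ ρ [] = refl
    subTs-renTs σ ρ (t ∷ ts) = cong₂ _∷_ (subT-renT σ ρ t) (subTs-renTs σ ρ ts)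

  mutual
    renT-subT : ∀ ρ σ t → renT ρ (subT σ t) ≡ subT (λ x → renT ρ (σ x)) t
    renT-subT ρ σ (var x) = refl
    renT-subT ρ σ (fun f ts) = cong (fun f) (renTs-subTs ρ σ ts)

    renTs-subTs : ∀ {n} ρ σ (ts : Vec Term n) →
                  renTs ρ (subTs σ ts) ≡ subTs (λ x → renT ρ (σ x)) ts
    renTs-subTs ρ σ [] = refl
    renTs-subTs ρ σ (t ∷ ts) = cong₂ _∷_ (renT-subT ρ σ t) (renTs-subTs ρ σ ts)

  _CancelsOn_ : (σ τ : ℕ → Term) → Set
  σ CancelsOn τ = ∀ x → subT σ (τ x) ≡ var x

  mutual
    subT-cancel : ∀ {σ τ} → σ CancelsOn τ → ∀ t → subT σ (subT τ t) ≡ t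
    subT-cancel στ (var x) = στ x
    subT-cancel στ (fun f ts) = cong (fun f) (subTs-cancel στ ts)

    subTs-cancel : ∀ {n σ τ} → σ CancelsOn τ → (ts : Vec Term n) →
                   subTs σ (subTs τ ts) ≡ ts
    subTs-cancel στ [] = refl
    subTs-cancel στ (t ∷ ts) = cong₂ _∷_ (subT-cancel στ t) (subTs-cancel στ ts)

  exts-cancel : ∀ {σ τ} → σ CancelsOn τ → exts σ CancelsOn exts τ
  exts-cancel στ zero = refl
  exts-cancel {σ} {τ} στ (suc x) =
    trans (subT-renT (exts σ) suc (τ x))
          (trans (sym (renT-subT suc σ (τ x))) (cong (renT suc) (στ x)))

  sub-cancel : ∀ {σ τ} → σ CancelsOn τ → ∀ A → sub σ (sub τ A) ≡ A
  sub-cancel στ (atom P ts) = cong (atom P) (subTs-cancel στ ts)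
  sub-cancel στ (t ≐ u) = cong₂ _≐_ (subT-cancel στ t) (subT-cancel στ u)
  sub-cancel στ ⊥' = refl
  sub-cancel στ (A ∨' B) = cong₂ _∨'_ (sub-cancel στ A) (sub-cancel στ B)
  sub-cancel στ (A ∧' B) = cong₂ _∧'_ (sub-cancel στ A) (sub-cancel στ B)
  sub-cancel στ (A ⊃ B) = cong₂ _⊃_ (sub-cancel στ A) (sub-cancel στ B)
  sub-cancel στ (∃' A) = cong ∃' (sub-cancel (exts-cancel στ) A)
  sub-cancel στ (∀' A) = cong ∀' (sub-cancel (exts-cancel στ) A)

  exts-wk-[var0] : ∀ A → sub (exts wk) A [ var zero ] ≡ A
  exts-wk-[var0] = sub-cancel inst-var0-cancels-exts-wk
    where
    inst-var0-cancels-exts-wk : inst (var zero) CancelsOn exts wk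
    inst-var0-cancels-exts-wk zero = refl
    inst-var0-cancels-exts-wk (suc x) = refl

  #0 : ∀ {Γ A} → A ∷ Γ ⊢ A
  #0 = ass (here refl)

  #1 : ∀ {Γ A B} → B ∷ A ∷ Γ ⊢ A
  #1 = ass (there (here refl))

  #2 : ∀ {Γ A B C} → C ∷ B ∷ A ∷ Γ ⊢ A
  #2 = ass (there (there (here refl)))

  Derivable : Fm → Set
  Derivable X = ∀ {Γ} → Γ ⊢ X

  infix 3 _⟷_
  _⟷_ : Fm → Fm → Set
  X ⟷ Y = Derivable (X ⊃ Y) × Derivable (Y ⊃ X)

  ⟷⇒⇔ : ∀ {X Y} → X ⟷ Y → Derivable (X ⇔ Y)
  ⟷⇒⇔ (f , g) = ∧I f g

  Stable : Fm → Set
  Stable X = Derivable (¬² X ⊃ X)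

  infixl 5 _⨾_
  _⨾_ : ∀ {X Y Z} → Derivable (X ⊃ Y) → Derivable (Y ⊃ Z) → Derivable (X ⊃ Z)
  f ⨾ g = ⊃I (⊃E g (⊃E f #0))

  ∧-intro : ∀ {X Y Z} → Derivable (Z ⊃ X) → Derivable (Z ⊃ Y) → Derivable (Z ⊃ X ∧' Y)
  ∧-intro f g = ⊃I (∧I (⊃E f #0) (⊃E g #0))

  ∧-proj₁ : ∀ {X Y} → Derivable (X ∧' Y ⊃ X)
  ∧-proj₁ = ⊃I (∧E₁ #0)

  ∧-proj₂ : ∀ {X Y} → Derivable (X ∧' Y ⊃ Y)
  ∧-proj₂ = ⊃I (∧E₂ #0)

  ∧-map : ∀ {X Y X′ Y′} → Derivable (X ⊃ X′) → Derivable (Y ⊃ Y′) →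
          Derivable (X ∧' Y ⊃ X′ ∧' Y′)
  ∧-map f g = ∧-intro (∧-proj₁ ⨾ f) (∧-proj₂ ⨾ g)

  ∨-inj₁ : ∀ {X Y} → Derivable (X ⊃ X ∨' Y)
  ∨-inj₁ = ⊃I (∨I₁ #0)

  ∨-inj₂ : ∀ {X Y} → Derivable (Y ⊃ X ∨' Y)
  ∨-inj₂ = ⊃I (∨I₂ #0)

  ∨-elim : ∀ {X Y Z} → Derivable (X ⊃ Z) → Derivable (Y ⊃ Z) → Derivable (X ∨' Y ⊃ Z)
  ∨-elim f g = ⊃I (∨E #0 (⊃E f #0) (⊃E g #0))

  ∨-map : ∀ {X Y X′ Y′} → Derivable (X ⊃ X′) → Derivable (Y ⊃ Y′) →
          Derivable (X ∨' Y ⊃ X′ ∨' Y′)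
  ∨-map f g = ∨-elim (f ⨾ ∨-inj₁) (g ⨾ ∨-inj₂)

  ⊃-map : ∀ {X Y X′ Y′} → Derivable (X′ ⊃ X) → Derivable (Y ⊃ Y′) →
          Derivable ((X ⊃ Y) ⊃ (X′ ⊃ Y′))
  ⊃-map f g = ⊃I (⊃I (⊃E g (⊃E #1 (⊃E f #0))))

  ∃-intro-var : ∀ {X} → Derivable (X ⊃ ↑ (∃' X))
  ∃-intro-var {X} {Γ} = ⊃I (∃I (var zero) (subst (X ∷ Γ ⊢_) (sym (exts-wk-[var0] X)) #0))

  ∃-elim : ∀ {X Z} → Derivable (X ⊃ ↑ Z) → Derivable (∃' X ⊃ Z)
  ∃-elim f = ⊃I (∃E #0 (⊃E f #0))

  ∃-map : ∀ {X Y} → Derivable (X ⊃ Y) → Derivable (∃' X ⊃ ∃' Y)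
  ∃-map f = ∃-elim (f ⨾ ∃-intro-var)

  ∀-elim-var : ∀ {X} → Derivable (↑ (∀' X) ⊃ X)
  ∀-elim-var {X} {Γ} = ⊃I (subst (↑ (∀' X) ∷ Γ ⊢_) (exts-wk-[var0] X) (∀E (var zero) #0))

  ∀-intro : ∀ {X Z} → Derivable (↑ Z ⊃ X) → Derivable (Z ⊃ ∀' X)
  ∀-intro f = ⊃I (∀I (⊃E f #0))

  ¬²-unit : ∀ {X} → Derivable (X ⊃ ¬² X)
  ¬²-unit = ⊃I (⊃I (⊃E #0 #1))

  ¬²-bind : ∀ {X Y} → Derivable (X ⊃ ¬² Y) → Derivable (¬² X ⊃ ¬² Y)
  ¬²-bind f = ⊃I (⊃I (⊃E #1 (⊃I (⊃E (⊃E f #0) #1))))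

  ¬²-map : ∀ {X Y} → Derivable (X ⊃ Y) → Derivable (¬² X ⊃ ¬² Y)
  ¬²-map f = ¬²-bind (f ⨾ ¬²-unit)

  ¬²-zip : ∀ {X Y} → Derivable (¬² X ∧' ¬² Y ⊃ ¬² (X ∧' Y))
  ¬²-zip = ⊃I (⊃I (⊃E (∧E₁ #1) (⊃I (⊃E (∧E₂ #2) (⊃I (⊃E #2 (∧I #1 #0)))))))

  -- ¬ (X ⊃ Y) yields both ¬ Y and ¬² X.
  ¬²-⊃-intro : ∀ {X Y} → Derivable ((¬² X ⊃ ¬² Y) ⊃ ¬² (X ⊃ Y))
  ¬²-⊃-intro = ⊃I (⊃I (⊃E (⊃E #1 (⊃I (⊃E #1 (⊃I (⊥E (⊃E #1 #0))))))
                           (⊃I (⊃E #1 (⊃I #1)))))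

  ¬²-⊃-elim : ∀ {X Y} → Derivable (¬² (X ⊃ Y) ⊃ ¬² X ⊃ ¬² Y)
  ¬²-⊃-elim = ⊃I (⊃I (⊃I (⊃E #2 (⊃I (⊃E #2 (⊃I (⊃E #2 (⊃E #1 #0))))))))

  ¬²-stable : ∀ {X} → Stable (¬² X)
  ¬²-stable = ¬²-bind (⊃I #0)

  ∧-stable : ∀ {X Y} → Stable X → Stable Y → Stable (X ∧' Y)
  ∧-stable sX sY = ∧-intro (¬²-map ∧-proj₁ ⨾ sX) (¬²-map ∧-proj₂ ⨾ sY)

  ⊃-stable : ∀ {X Y} → Stable Y → Stable (X ⊃ Y)
  ⊃-stable sY = ¬²-⊃-elim ⨾ ⊃-map ¬²-unit sY

  ∀-stable : ∀ {X} → Stable X → Stable (∀' X)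
  ∀-stable sX = ∀-intro (¬²-map ∀-elim-var ⨾ sX)

  ¬²-∨-cong : ∀ {X Y X′ Y′} → X ⟷ ¬² X′ → Y ⟷ ¬² Y′ → ¬² (X ∨' Y) ⟷ ¬² (X′ ∨' Y′)
  ¬²-∨-cong (fX , bX) (fY , bY) =
    ¬²-bind (∨-elim (fX ⨾ ¬²-map ∨-inj₁) (fY ⨾ ¬²-map ∨-inj₂)) ,
    ¬²-map (∨-map (¬²-unit ⨾ bX) (¬²-unit ⨾ bY))

  ∧-¬²-cong : ∀ {X Y X′ Y′} → X ⟷ ¬² X′ → Y ⟷ ¬² Y′ → (X ∧' Y) ⟷ ¬² (X′ ∧' Y′)
  ∧-¬²-cong (fX , bX) (fY , bY) =
    ∧-map fX fY ⨾ ¬²-zip ,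
    ∧-intro (¬²-map ∧-proj₁ ⨾ bX) (¬²-map ∧-proj₂ ⨾ bY)

  ⊃-¬²-cong : ∀ {X Y X′ Y′} → X ⟷ ¬² X′ → Y ⟷ ¬² Y′ → (X ⊃ Y) ⟷ ¬² (X′ ⊃ Y′)
  ⊃-¬²-cong (fX , bX) (fY , bY) =
    ⊃-map bX fY ⨾ ¬²-⊃-intro ,
    ¬²-⊃-elim ⨾ ⊃-map fX bY

  ¬²-∃-cong : ∀ {X X′} → X ⟷ ¬² X′ → ¬² (∃' X) ⟷ ¬² (∃' X′)
  ¬²-∃-cong (fX , bX) =
    ¬²-bind (∃-elim (fX ⨾ ¬²-map ∃-intro-var)) ,
    ¬²-map (∃-map (¬²-unit ⨾ bX))

  ᶠ-stable : ∀ A → Stable (A ᶠ)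
  ᶠ-stable (atom P ts) = ¬²-stable
  ᶠ-stable (t ≐ u) = ¬²-stable
  ᶠ-stable ⊥' = ¬²-stable
  ᶠ-stable (A ∨' B) = ¬²-stable
  ᶠ-stable (A ∧' B) = ∧-stable (ᶠ-stable A) (ᶠ-stable B)
  ᶠ-stable (A ⊃ B) = ⊃-stable (ᶠ-stable B)
  ᶠ-stable (□ A) = ᶠ-stable A
  ᶠ-stable (∃' A) = ¬²-stable
  ᶠ-stable (∀' A) = ∀-stable (ᶠ-stable A)

  ᶠ⟷¬²ᵈ : ∀ A → NoForall A → A ᶠ ⟷ ¬² (A ᵈ)
  ᶠ⟷¬²ᵈ (atom P ts) _ = ⊃I #0 , ⊃I #0
  ᶠ⟷¬²ᵈ (t ≐ u) _ = ⊃I #0 , ⊃I #0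
  ᶠ⟷¬²ᵈ ⊥' _ = ⊃I #0 , ⊃I #0
  ᶠ⟷¬²ᵈ (A ∨' B) (nA , nB) = ¬²-∨-cong (ᶠ⟷¬²ᵈ A nA) (ᶠ⟷¬²ᵈ B nB)
  ᶠ⟷¬²ᵈ (A ∧' B) (nA , nB) = ∧-¬²-cong (ᶠ⟷¬²ᵈ A nA) (ᶠ⟷¬²ᵈ B nB)
  ᶠ⟷¬²ᵈ (A ⊃ B) (nA , nB) = ⊃-¬²-cong (ᶠ⟷¬²ᵈ A nA) (ᶠ⟷¬²ᵈ B nB)
  ᶠ⟷¬²ᵈ (□ A) nA = ᶠ⟷¬²ᵈ A nA
  ᶠ⟷¬²ᵈ (∃' A) nA = ¬²-∃-cong (ᶠ⟷¬²ᵈ A nA)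

lemma5p1 : (Fn Pr : ℕ → Set) (A : FOL.MFm Fn Pr) →
    (FOL.NoForall Fn Pr A → FOL.⊢IQC Fn Pr (FOL._⇔_ Fn Pr (FOL._ᶠ Fn Pr A) (FOL.¬² Fn Pr (FOL._ᵈ Fn Pr A))))
    × FOL.⊢IQC Fn Pr (FOL._⇔_ Fn Pr (FOL._ᶠ Fn Pr A) (FOL.¬² Fn Pr (FOL._ᶠ Fn Pr A)))
lemma5p1 Fn Pr A =
  (λ nA → ⟷⇒⇔ (ᶠ⟷¬²ᵈ A nA)) ,
  ⟷⇒⇔ (¬²-unit , ᶠ-stable A)
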